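{- In the setting described in the context, assume $N\equiv0\pmod 3$ and let $r\in\{0,1,2\}$ with $A\frac{C}{N}=\frac{B^2-D}{4N}\equiv r\pmod 3$. Then $3\mid\theta$ if (a) $3\mid D$ and $r=1$; or (b) $D\equiv1\pmod3$ and $r=2$. In these cases $B$ satisfies: in case (a) $3\mid B$; in case (b) $3\nmid B$.
   Context: Setting: Let $N>1$ be an integer, $N=2^{\lambda(N)}N_1$ with $N_1$ odd. Let $D=c^2\Delta<0$ be a discriminant with fundamental part $\Delta$ and conductor $c$, $K=\mathbb Q(\sqrt D)$, $\mathcal O$ the order of discriminant $D$. Let $[A,B,C]$ be a primitive positive definite integral quadratic form with $B^2-4AC=D$, $\gcd(A,N)=1$ and $N\mid C$ (equivalently $B^2\equiv D\pmod{4N}$). Let $\alpha=\frac{ -B+\sqrt D}{2A}$, so $\mathcal O=\mathbb Z+\mathbb Z A\alpha$. Let $u,v\in\mathbb Z$ be such that $\pi=u+vA\alpha$ has norm $p=u^2-uvB+v^2AC$ a prime number not dividing $6cN$ that splits in $\mathcal O$, and assume $p\mid C$ and $p\mid u$. Set $u'=u-vB$. Let $v_1$, $A_1$ be the odd parts of $v$, $A$ ($v=2^av_1$, $A=2^bA_1$ with $v_1,A_1$ odd; $v_1=1$ if $v=0$). Define the integer $\theta=(N-1)v\left(u'\frac{C}{Np}+A\left(\frac up(1-u'^2)-u'\right)\right)+3v_1A_1(N_1-1)(u'-1)+\frac{3\lambda(N)(u'^2-1)}{2}.$ -}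

module Defs where

open import Data.Nat as ℕ using (ℕ; NonZero)
open import Data.Integer using (ℤ; +_; _+_; _-_; _*_; -_; _<_)
open import Data.Integer.DivMod using (_/ℕ_)
open import Data.Integer.Divisibility using (_∣_)
open import Data.Product using (_×_; ∃)
open import Data.Sum using (_⊎_)
open import Relation.Nullary using (¬_)
open import Relation.Binary.PropositionalEquality using (_≡_)

Odd : ℤ → Set
Odd x = ¬ (+ 2 ∣ x)

SquareFree : ℤ → Set
SquareFree m = ∀ (d : ℕ) → (+ d * + d) ∣ m → d ≡ 1

-- Fundamental discriminant (as usual): Δ ≡ 1 (mod 4) square-free, or
-- Δ = 4m with m ≡ 2,3 (mod 4) square-free.  (Δ ≠ 1 is automatic here since Δ < 0.)
FundamentalDiscriminant : ℤ → Set
FundamentalDiscriminant Δ =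
  (+ 4 ∣ (Δ - + 1) × SquareFree Δ)
  ⊎ ∃ λ m → Δ ≡ + 4 * m × SquareFree m × ((+ 4 ∣ (m - + 2)) ⊎ (+ 4 ∣ (m - + 3)))

-- A prime p not dividing the conductor (p odd) splits in the order of
-- discriminant D iff D is a nonzero square modulo p, i.e. (D/p) = 1.
SplitsInOrder : ℤ → ℕ → Set
SplitsInOrder D p = ¬ (+ p ∣ D) × ∃ λ x → + p ∣ (x * x - D)

-- The integer θ of the paper.  Here lam = λ(N), N₁ the odd part of N,
-- v₁ , A₁ the odd parts of v , A, and u' = u - vB.
-- Exact divisions: C/(Np) is computed as (C/N)/p, u/p and (...)/2.
theta : (N p : ℕ) .{{_ : NonZero N}} .{{_ : NonZero p}}
        (lam N₁ : ℕ) (A B C u v v₁ A₁ : ℤ) → ℤ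
theta N p lam N₁ A B C u v v₁ A₁ =
    (+ N - + 1) * v * (u' * ((C /ℕ N) /ℕ p)
                       + A * ((u /ℕ p) * (+ 1 - u' * u') - u'))
  + + 3 * v₁ * A₁ * (+ N₁ - + 1) * (u' - + 1)
  + ((+ 3 * + lam * (u' * u' - + 1)) /ℕ 2)
  where
  u' : ℤ
  u' = u - v * B

{-# OPTIONS --safe #-}

-- Work modulo 3 with M = C/N, M' = C/(Np), w = u/p and u' = u - vB.  As 3 ∣ N ∣ C, the norm
-- equation reads p ≡ u·u' and the discriminant D ≡ B², which already settles the claims on B;
-- u' is a unit, so u'² ≡ 1 and θ ≡ -v·u'·(M' - A).  (The halved term of θ is a multiple of 3:
-- the halving is exact because u' is odd whenever N is even.)  In case (a), 3 ∣ B gives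
-- p ≡ u² ≡ 1; in case (b) with 3 ∤ v, uvB ≡ ±1 and uvB ≡ 1 would force 3 ∣ p, so p ≡ -1.
-- Either way A·M'·p = A·(C/N) ≡ p, hence A·M' ≡ 1 and M' ≡ A⁻¹ ≡ A.

module Submission where

open import Defs
open import Data.Nat as ℕ using (ℕ; NonZero)
open import Data.Nat.Primality using (Prime)
open import Data.Integer using (ℤ; +_; _+_; _-_; _*_; -_; _<_)
open import Data.Integer.DivMod using (_/ℕ_)
open import Data.Integer.Divisibility using (_∣_)
open import Data.Integer.GCD using (gcd)
open import Data.Product using (_×_; ∃)
open import Relation.Nullary using (¬_)
open import Relation.Binary.PropositionalEquality using (_≡_; _≢_)

open import Data.Empty using (⊥-elim)
open import Data.Integer using (∣_∣)
open import Data.Integer.DivMod using (_%ℕ_; a≡a%ℕn+[a/ℕn]*n; n%ℕd<d)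
open import Data.Integer.Divisibility.Signed
  using ( divides; _∣?_; ∣ᵤ⇒∣; ∣⇒∣ᵤ; ∣-refl
        ; ∣m∣n⇒∣m+n; ∣m∣n⇒∣m-n; ∣m⇒∣m*n; ∣n⇒∣m*n)
  renaming (_∣_ to _∣ₛ_)
open import Data.Integer.Properties using (abs-*; +-identityˡ; +-identityʳ)
open import Data.Nat.Properties using (<⇒≱)
open import Data.Integer.Tactic.RingSolver using (solve-∀)
import Data.Nat.Divisibility as ℕ
open import Data.Nat.Primality using (euclidsLemma; prime⇒irreducible; prime?)
open import Data.Product using (_,_; proj₁; proj₂)
open import Data.Sum using (_⊎_; inj₁; inj₂; map; [_,_]′)
open import Function using (id)
open import Relation.Nullary using (yes; no)
open import Relation.Nullary.Decidable using (toWitness)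
open import Relation.Binary.PropositionalEquality using (refl; sym; subst; cong; module ≡-Reasoning)

∣-respʳ : ∀ {d x y} → x ≡ y → d ∣ₛ x → d ∣ₛ y
∣-respʳ refl d∣x = d∣x

euclidsLemma-ℤ : ∀ {p} x y → Prime p → + p ∣ₛ x * y → + p ∣ₛ x ⊎ + p ∣ₛ y
euclidsLemma-ℤ {p} x y p-prime p∣xy =
  map ∣ᵤ⇒∣ ∣ᵤ⇒∣ (euclidsLemma ∣ x ∣ ∣ y ∣ p-prime
    (subst (p ℕ.∣_) (abs-* x y) (∣⇒∣ᵤ p∣xy)))

prime[3] : Prime 3
prime[3] = toWitness {a? = prime? 3} _

∣x-x%ℕd : ∀ x d .{{_ : NonZero d}} → + d ∣ₛ x - + (x %ℕ d)
∣x-x%ℕd x d = divides (x /ℕ d) (begin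
  x - + (x %ℕ d)                         ≡⟨ cong (_- + (x %ℕ d)) (a≡a%ℕn+[a/ℕn]*n x d) ⟩
  + (x %ℕ d) + x /ℕ d * + d - + (x %ℕ d) ≡⟨ a+b-a≡b (+ (x %ℕ d)) (x /ℕ d * + d) ⟩
  x /ℕ d * + d                           ∎)
  where
  open ≡-Reasoning
  a+b-a≡b : ∀ a b → a + b - a ≡ b
  a+b-a≡b = solve-∀

∣⇒x≡[x/ℕd]*d : ∀ {x} d .{{_ : NonZero d}} → + d ∣ₛ x → x ≡ x /ℕ d * + d
∣⇒x≡[x/ℕd]*d {x} d d∣x = begin
  x                          ≡⟨ a≡a%ℕn+[a/ℕn]*n x d ⟩
  + (x %ℕ d) + x /ℕ d * + d  ≡⟨ cong (λ r → + r + x /ℕ d * + d) remainder≡0 ⟩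
  + 0 + x /ℕ d * + d         ≡⟨ +-identityˡ (x /ℕ d * + d) ⟩
  x /ℕ d * + d               ∎
  where
  open ≡-Reasoning
  d∣remainder : d ℕ.∣ x %ℕ d
  d∣remainder = ∣⇒∣ᵤ (∣-respʳ (a-[a-b]≡b x (+ (x %ℕ d))) (∣m∣n⇒∣m-n d∣x (∣x-x%ℕd x d)))
    where
    a-[a-b]≡b : ∀ a b → a - (a - b) ≡ b
    a-[a-b]≡b = solve-∀
  <∧∣⇒≡0 : ∀ {r} → r ℕ.< d → d ℕ.∣ r → r ≡ 0
  <∧∣⇒≡0 {ℕ.zero}  _   _   = refl
  <∧∣⇒≡0 {ℕ.suc r} r<d d∣r = ⊥-elim (<⇒≱ r<d (ℕ.∣⇒≤ d∣r))
  remainder≡0 : x %ℕ d ≡ 0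
  remainder≡0 = <∧∣⇒≡0 (n%ℕd<d x d) d∣remainder

¬2∣⇒2∣x-1 : ∀ x → ¬ + 2 ∣ₛ x → + 2 ∣ₛ x - + 1
¬2∣⇒2∣x-1 x 2∤x with x %ℕ 2 | n%ℕd<d x 2 | ∣x-x%ℕd x 2
... | 0 | _ | 2∣x-0 = ⊥-elim (2∤x (∣-respʳ (+-identityʳ x) 2∣x-0))
... | 1 | _ | 2∣x-1 = 2∣x-1
... | ℕ.suc (ℕ.suc _) | ℕ.s≤s (ℕ.s≤s ()) | _

¬3∣⇒3∣x∓1 : ∀ x → ¬ + 3 ∣ₛ x → + 3 ∣ₛ x - + 1 ⊎ + 3 ∣ₛ x + + 1
¬3∣⇒3∣x∓1 x 3∤x with x %ℕ 3 | n%ℕd<d x 3 | ∣x-x%ℕd x 3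
... | 0 | _ | 3∣x-0 = ⊥-elim (3∤x (∣-respʳ (+-identityʳ x) 3∣x-0))
... | 1 | _ | 3∣x-1 = inj₁ 3∣x-1
... | 2 | _ | 3∣x-2 = inj₂ (∣-respʳ (a-2+3≡a+1 x) (∣m∣n⇒∣m+n 3∣x-2 ∣-refl))
  where
  a-2+3≡a+1 : ∀ a → a - + 2 + + 3 ≡ a + + 1
  a-2+3≡a+1 = solve-∀
... | ℕ.suc (ℕ.suc (ℕ.suc _)) | ℕ.s≤s (ℕ.s≤s (ℕ.s≤s ())) | _

∣x∓1⇒∣x*x-1 : ∀ {d} x → d ∣ₛ x - + 1 ⊎ d ∣ₛ x + + 1 → d ∣ₛ x * x - + 1
∣x∓1⇒∣x*x-1 x d∣x∓1 =
  ∣-respʳ (identity x) ([ ∣m⇒∣m*n (x + + 1) , ∣n⇒∣m*n (x - + 1) ]′ d∣x∓1)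
  where
  identity : ∀ a → (a - + 1) * (a + + 1) ≡ a * a - + 1
  identity = solve-∀

1+n<d⇒d∤1+n : ∀ {d} n → ℕ.suc n ℕ.< d → ¬ + d ∣ₛ + ℕ.suc n
1+n<d⇒d∤1+n n n<d d∣n = <⇒≱ n<d (ℕ.∣⇒≤ (∣⇒∣ᵤ d∣n))

∤∧∤⇒∤* : ∀ {q x y} → Prime q → ¬ + q ∣ₛ x → ¬ + q ∣ₛ y → ¬ + q ∣ₛ x * y
∤∧∤⇒∤* {x = x} {y} q-prime q∤x q∤y q∣xy = [ q∤x , q∤y ]′ (euclidsLemma-ℤ x y q-prime q∣xy)

∣P-x*y∧∤P⇒∤x×∤y : ∀ {d P} x y → d ∣ₛ P - x * y → ¬ d ∣ₛ P → ¬ d ∣ₛ x × ¬ d ∣ₛ y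
∣P-x*y∧∤P⇒∤x×∤y {P = P} x y d∣P-xy d∤P =
  (λ d∣x → d∤P (∣-respʳ (a-b+b≡a P (x * y)) (∣m∣n⇒∣m+n d∣P-xy (∣m⇒∣m*n y d∣x))))
  , (λ d∣y → d∤P (∣-respʳ (a-b+b≡a P (x * y)) (∣m∣n⇒∣m+n d∣P-xy (∣n⇒∣m*n x d∣y))))
  where
  a-b+b≡a : ∀ a b → a - b + b ≡ a
  a-b+b≡a = solve-∀

∣xy-1∧∣x*x-1⇒∣y-x : ∀ {d} x y → d ∣ₛ x * y - + 1 → d ∣ₛ x * x - + 1 → d ∣ₛ y - x
∣xy-1∧∣x*x-1⇒∣y-x x y d∣xy-1 d∣xx-1 =
  ∣-respʳ (identity x y) (∣m∣n⇒∣m-n (∣n⇒∣m*n x d∣xy-1) (∣n⇒∣m*n y d∣xx-1))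
  where
  identity : ∀ x y → x * (x * y - + 1) - y * (x * x - + 1) ≡ y - x
  identity = solve-∀

3∣xy-1⇒3∤x : ∀ x y → + 3 ∣ₛ x * y - + 1 → ¬ + 3 ∣ₛ x
3∣xy-1⇒3∤x x y 3∣xy-1 3∣x =
  1+n<d⇒d∤1+n 0 (ℕ.s≤s (ℕ.s≤s ℕ.z≤n))
    (∣-respʳ (a-[a-1]≡1 (x * y)) (∣m∣n⇒∣m-n (∣m⇒∣m*n y 3∣x) 3∣xy-1))
  where
  a-[a-1]≡1 : ∀ a → a - (a - + 1) ≡ + 1
  a-[a-1]≡1 = solve-∀

3∣xy-1⇒3∣y-x : ∀ x y → + 3 ∣ₛ x * y - + 1 → + 3 ∣ₛ y - x
3∣xy-1⇒3∣y-x x y 3∣xy-1 =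
  ∣xy-1∧∣x*x-1⇒∣y-x x y 3∣xy-1 (∣x∓1⇒∣x*x-1 x (¬3∣⇒3∣x∓1 x (3∣xy-1⇒3∤x x y 3∣xy-1)))

3∣x∧2∣x⇒3∣x/ℕ2 : ∀ x → + 3 ∣ₛ x → + 2 ∣ₛ x → + 3 ∣ₛ x /ℕ 2
3∣x∧2∣x⇒3∣x/ℕ2 x 3∣x 2∣x =
  [ id , (λ 3∣2 → ⊥-elim (1+n<d⇒d∤1+n 1 (ℕ.s≤s (ℕ.s≤s (ℕ.s≤s ℕ.z≤n))) 3∣2)) ]′
    (euclidsLemma-ℤ (x /ℕ 2) (+ 2) prime[3] (∣-respʳ (∣⇒x≡[x/ℕd]*d 2 2∣x) 3∣x))

3∣[3λy]/ℕ2 : ∀ lam y → (lam ≢ 0 → + 2 ∣ₛ y) → + 3 ∣ₛ (+ 3 * + lam * y) /ℕ 2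
3∣[3λy]/ℕ2 ℕ.zero    y _          = divides (+ 0) refl
3∣[3λy]/ℕ2 (ℕ.suc l) y λ≢0⇒2∣y =
  3∣x∧2∣x⇒3∣x/ℕ2 (+ 3 * + ℕ.suc l * y)
    (∣m⇒∣m*n y (∣m⇒∣m*n (+ ℕ.suc l) ∣-refl))
    (∣n⇒∣m*n (+ 3 * + ℕ.suc l) (λ≢0⇒2∣y λ ()))

3∣theta-expression : ∀ n v u' M' A w v₁ A₁ n₁ t →
  + 3 ∣ₛ n → + 3 ∣ₛ v * (M' - A) → + 3 ∣ₛ u' * u' - + 1 → + 3 ∣ₛ t →
  + 3 ∣ₛ (n - + 1) * v * (u' * M' + A * (w * (+ 1 - u' * u') - u'))
         + + 3 * v₁ * A₁ * (n₁ - + 1) * (u' - + 1) + t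
3∣theta-expression n v u' M' A w v₁ A₁ n₁ t 3∣n 3∣v[M'-A] 3∣u'²-1 3∣t =
  ∣-respʳ (identity n v u' M' A w v₁ A₁ n₁ t)
    (∣m∣n⇒∣m+n (∣m∣n⇒∣m+n (∣m∣n⇒∣m+n (∣m∣n⇒∣m-n
      (∣m⇒∣m*n (v * (u' * M' + A * (w * (+ 1 - u' * u') - u'))) 3∣n)
      (∣n⇒∣m*n u' 3∣v[M'-A]))
      (∣n⇒∣m*n (v * A * w) 3∣u'²-1))
      (∣m⇒∣m*n (v₁ * A₁ * (n₁ - + 1) * (u' - + 1)) ∣-refl))
      3∣t)
  where
  identity : ∀ n v u' M' A w v₁ A₁ n₁ t →
    n * (v * (u' * M' + A * (w * (+ 1 - u' * u') - u'))) - u' * (v * (M' - A))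
      + v * A * w * (u' * u' - + 1) + + 3 * (v₁ * A₁ * (n₁ - + 1) * (u' - + 1)) + t
    ≡ (n - + 1) * v * (u' * M' + A * (w * (+ 1 - u' * u') - u'))
      + + 3 * v₁ * A₁ * (n₁ - + 1) * (u' - + 1) + t
  identity = solve-∀

∣C∧∣D-r⇒∣B*B-r : ∀ {d C D} A B r →
  d ∣ₛ C → B * B - + 4 * A * C ≡ D → d ∣ₛ D - r → d ∣ₛ B * B - r
∣C∧∣D-r⇒∣B*B-r {C = C} A B r d∣C refl d∣D-r =
  ∣-respʳ (identity A B C r) (∣m∣n⇒∣m+n d∣D-r (∣n⇒∣m*n (+ 4 * A) d∣C))
  where
  identity : ∀ A B C r → B * B - + 4 * A * C - r + + 4 * A * C ≡ B * B - r
  identity = solve-∀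

q∣k∧p∤k⇒q∤p : ∀ {p q k} → Prime p → q ≢ 1 → q ℕ.∣ k → ¬ p ℕ.∣ k → ¬ q ℕ.∣ p
q∣k∧p∤k⇒q∤p p-prime q≢1 q∣k p∤k q∣p with prime⇒irreducible p-prime q∣p
... | inj₁ q≡1 = q≢1 q≡1
... | inj₂ refl = p∤k q∣k

λ≢0⇒2∣2^λ*n : ∀ lam n → lam ≢ 0 → 2 ℕ.∣ 2 ℕ.^ lam ℕ.* n
λ≢0⇒2∣2^λ*n ℕ.zero    n λ≢0 = ⊥-elim (λ≢0 refl)
λ≢0⇒2∣2^λ*n (ℕ.suc l) n _   = ℕ.∣m⇒∣m*n n (ℕ.m∣m*n (2 ℕ.^ l))

module Norm {p : ℕ} (u v B A C : ℤ) (norm : + p ≡ u * u - u * v * B + v * v * A * C) where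

  ∣C⇒∣p-u*u' : ∀ {d} → d ∣ₛ C → d ∣ₛ + p - u * (u - v * B)
  ∣C⇒∣p-u*u' d∣C rewrite norm = ∣-respʳ (identity u v B A C) (∣n⇒∣m*n (v * v * A) d∣C)
    where
    identity : ∀ u v B A C → v * v * A * C ≡ u * u - u * v * B + v * v * A * C - u * (u - v * B)
    identity = solve-∀

  ∣C∧∤p⇒∤u×∤u' : ∀ {d} → d ∣ₛ C → ¬ d ∣ₛ + p → ¬ d ∣ₛ u × ¬ d ∣ₛ u - v * B
  ∣C∧∤p⇒∤u×∤u' d∣C = ∣P-x*y∧∤P⇒∤x×∤y u (u - v * B) (∣C⇒∣p-u*u' d∣C)

  module _ (3∣C : + 3 ∣ₛ C) (3∤p : ¬ + 3 ∣ₛ + p) where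

    3∣p-1+uvB : + 3 ∣ₛ + p - + 1 + u * v * B
    3∣p-1+uvB = ∣-respʳ (identity (+ p) u v B) (∣m∣n⇒∣m+n (∣C⇒∣p-u*u' 3∣C) 3∣u*u-1)
      where
      3∣u*u-1 : + 3 ∣ₛ u * u - + 1
      3∣u*u-1 = ∣x∓1⇒∣x*x-1 u (¬3∣⇒3∣x∓1 u (proj₁ (∣C∧∤p⇒∤u×∤u' 3∣C 3∤p)))
      identity : ∀ P u v B → P - u * (u - v * B) + (u * u - + 1) ≡ P - + 1 + u * v * B
      identity = solve-∀

    3∣B⇒3∣p-1 : + 3 ∣ₛ B → + 3 ∣ₛ + p - + 1
    3∣B⇒3∣p-1 3∣B =
      ∣-respʳ (identity (+ p) (u * v * B)) (∣m∣n⇒∣m-n 3∣p-1+uvB (∣n⇒∣m*n (u * v) 3∣B))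
      where
      identity : ∀ P x → P - + 1 + x - x ≡ P - + 1
      identity = solve-∀

    3∤B∧3∤v⇒3∣p+1 : ¬ + 3 ∣ₛ B → ¬ + 3 ∣ₛ v → + 3 ∣ₛ + p + + 1
    3∤B∧3∤v⇒3∣p+1 3∤B 3∤v =
      [ (λ 3∣uvB-1 → ⊥-elim (3∤p (∣-respʳ (p≡ (+ p) (u * v * B))
          (∣m∣n⇒∣m-n 3∣p-1+uvB 3∣uvB-1))))
      , (λ 3∣uvB+1 → ∣-respʳ (p+1≡ (+ p) (u * v * B))
          (∣m∣n⇒∣m+n (∣m∣n⇒∣m-n 3∣p-1+uvB 3∣uvB+1) ∣-refl))
      ]′ (¬3∣⇒3∣x∓1 (u * v * B) 3∤uvB)
      where
      3∤uvB : ¬ + 3 ∣ₛ u * v * B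
      3∤uvB = ∤∧∤⇒∤* prime[3]
        (∤∧∤⇒∤* prime[3] (proj₁ (∣C∧∤p⇒∤u×∤u' 3∣C 3∤p)) 3∤v) 3∤B
      p≡ : ∀ P x → P - + 1 + x - (x - + 1) ≡ P
      p≡ = solve-∀
      p+1≡ : ∀ P x → P - + 1 + x - (x + + 1) + + 3 ≡ P + + 1
      p+1≡ = solve-∀

module LevelDivisibleBy3
  {N p : ℕ} .{{_ : NonZero N}} .{{_ : NonZero p}} (c : ℕ) (A B C D u v : ℤ)
  (p-prime : Prime p) (p∤6cN : ¬ p ℕ.∣ 6 ℕ.* c ℕ.* N)
  (disc : B * B - + 4 * A * C ≡ D) (norm : + p ≡ u * u - u * v * B + v * v * A * C)
  (N∣C : + N ∣ₛ C) (p∣C : + p ∣ₛ C) (3∣N : + 3 ∣ₛ + N)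
  where

  open Norm u v B A C norm

  M M' u' : ℤ
  M  = C /ℕ N
  M' = M /ℕ p
  u' = u - v * B

  C≡M*N : C ≡ M * + N
  C≡M*N = ∣⇒x≡[x/ℕd]*d N N∣C

  ∣N⇒∣C : ∀ {d} → d ∣ₛ + N → d ∣ₛ C
  ∣N⇒∣C d∣N = ∣-respʳ (sym C≡M*N) (∣n⇒∣m*n M d∣N)

  M≡M'*p : M ≡ M' * + p
  M≡M'*p =
    [ ∣⇒x≡[x/ℕd]*d p , (λ p∣N → ⊥-elim (p∤6cN (ℕ.∣n⇒∣m*n (6 ℕ.* c) (∣⇒∣ᵤ p∣N)))) ]′
    (euclidsLemma-ℤ M (+ N) p-prime (∣-respʳ C≡M*N p∣C))

  q∣6⇒q∤p : ∀ {q} → q ≢ 1 → q ℕ.∣ 6 → ¬ + q ∣ₛ + p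
  q∣6⇒q∤p q≢1 q∣6 q∣p =
    q∣k∧p∤k⇒q∤p p-prime q≢1 (ℕ.∣m⇒∣m*n N (ℕ.∣m⇒∣m*n c q∣6)) p∤6cN (∣⇒∣ᵤ q∣p)

  3∣C : + 3 ∣ₛ C
  3∣C = ∣N⇒∣C 3∣N

  3∤p : ¬ + 3 ∣ₛ + p
  3∤p = q∣6⇒q∤p (λ ()) (ℕ.divides 2 refl)

  3∣u'*u'-1 : + 3 ∣ₛ u' * u' - + 1
  3∣u'*u'-1 = ∣x∓1⇒∣x*x-1 u' (¬3∣⇒3∣x∓1 u' (proj₂ (∣C∧∤p⇒∤u×∤u' 3∣C 3∤p)))

  2∣N⇒2∣u'*u'-1 : + 2 ∣ₛ + N → + 2 ∣ₛ u' * u' - + 1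
  2∣N⇒2∣u'*u'-1 2∣N = ∣x∓1⇒∣x*x-1 u' (inj₁ (¬2∣⇒2∣x-1 u'
    (proj₂ (∣C∧∤p⇒∤u×∤u' (∣N⇒∣C 2∣N) (q∣6⇒q∤p (λ ()) (ℕ.divides 3 refl))))))

  -- Cancelling p in A·M'·p ≡ p gives A·M' ≡ 1, and a unit mod 3 is its own inverse.
  3∣AM-p⇒3∣M'-A : + 3 ∣ₛ A * M - + p → + 3 ∣ₛ M' - A
  3∣AM-p⇒3∣M'-A 3∣AM-p = 3∣xy-1⇒3∣y-x A M' ([ id , (λ 3∣p → ⊥-elim (3∤p 3∣p)) ]′
    (euclidsLemma-ℤ (A * M' - + 1) (+ p) prime[3] (∣-respʳ (identity A M' (+ p)) 3∣AM'p-p)))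
    where
    3∣AM'p-p : + 3 ∣ₛ A * (M' * + p) - + p
    3∣AM'p-p = ∣-respʳ (cong (λ m → A * m - + p) M≡M'*p) 3∣AM-p
    identity : ∀ A M' P → A * (M' * P) - P ≡ (A * M' - + 1) * P
    identity = solve-∀

  case-a : + 3 ∣ₛ D → + 3 ∣ₛ A * M - + 1 → + 3 ∣ₛ v * (M' - A) × + 3 ∣ₛ B
  case-a 3∣D 3∣AM-1 = ∣n⇒∣m*n v (3∣AM-p⇒3∣M'-A 3∣AM-p) , 3∣B
    where
    3∣B*B : + 3 ∣ₛ B * B
    3∣B*B = ∣-respʳ (+-identityʳ (B * B))
      (∣C∧∣D-r⇒∣B*B-r A B (+ 0) 3∣C disc (∣-respʳ (sym (+-identityʳ D)) 3∣D))
    3∣B : + 3 ∣ₛ B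
    3∣B = [ id , id ]′ (euclidsLemma-ℤ B B prime[3] 3∣B*B)
    3∣AM-p : + 3 ∣ₛ A * M - + p
    3∣AM-p = ∣-respʳ (identity (A * M) (+ p)) (∣m∣n⇒∣m-n 3∣AM-1 (3∣B⇒3∣p-1 3∣C 3∤p 3∣B))
      where
      identity : ∀ x P → x - + 1 - (P - + 1) ≡ x - P
      identity = solve-∀

  case-b : + 3 ∣ₛ D - + 1 → + 3 ∣ₛ A * M - + 2 → + 3 ∣ₛ v * (M' - A) × ¬ + 3 ∣ₛ B
  case-b 3∣D-1 3∣AM-2 = 3∣v[M'-A] , 3∤B
    where
    3∤B : ¬ + 3 ∣ₛ B
    3∤B = 3∣xy-1⇒3∤x B B (∣C∧∣D-r⇒∣B*B-r A B (+ 1) 3∣C disc 3∣D-1)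
    3∣v[M'-A] : + 3 ∣ₛ v * (M' - A)
    3∣v[M'-A] with + 3 ∣? v
    ... | yes 3∣v = ∣m⇒∣m*n (M' - A) 3∣v
    ... | no  3∤v = ∣n⇒∣m*n v (3∣AM-p⇒3∣M'-A (∣-respʳ (identity (A * M) (+ p))
      (∣m∣n⇒∣m+n (∣m∣n⇒∣m-n 3∣AM-2 (3∤B∧3∤v⇒3∣p+1 3∣C 3∤p 3∤B 3∤v)) ∣-refl)))
      where
      identity : ∀ x P → x - + 2 - (P + + 1) + + 3 ≡ x - P
      identity = solve-∀

mainTheorem4 :
    -- N > 1 with N = 2^λ N₁, N₁ odd
    (N : ℕ) .{{_ : NonZero N}} → 1 ℕ.< N →
    (lam N₁ : ℕ) → N ≡ 2 ℕ.^ lam ℕ.* N₁ → Odd (+ N₁) →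
    -- D = c² Δ < 0, Δ fundamental, c the conductor
    (D Δ : ℤ) (c : ℕ) → 1 ℕ.≤ c → FundamentalDiscriminant Δ →
    D ≡ + c * + c * Δ → D < + 0 →
    -- primitive positive definite form [A,B,C] of discriminant D, gcd(A,N)=1, N ∣ C
    (A B C : ℤ) → + 0 < A → B * B - + 4 * A * C ≡ D →
    gcd (gcd A B) C ≡ + 1 → gcd A (+ N) ≡ + 1 → + N ∣ C →
    -- π = u + vAα of prime norm p, p ∤ 6cN, p split in O, p ∣ C, p ∣ u
    (u v : ℤ) (p : ℕ) .{{_ : NonZero p}} → Prime p →
    + p ≡ u * u - u * v * B + v * v * A * C →
    ¬ (+ p ∣ + (6 ℕ.* c ℕ.* N)) → SplitsInOrder D p →
    + p ∣ C → + p ∣ u →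
    -- odd parts v₁ of v (v₁ = 1 if v = 0) and A₁ of A
    (a b : ℕ) (v₁ A₁ : ℤ) →
    v ≡ + (2 ℕ.^ a) * v₁ → Odd v₁ → (v ≡ + 0 → v₁ ≡ + 1) →
    A ≡ + (2 ℕ.^ b) * A₁ → Odd A₁ →
    -- N ≡ 0 (mod 3)
    + 3 ∣ + N →
    -- case (a): 3 ∣ D and A(C/N) ≡ 1 (mod 3)  ⟹  3 ∣ θ and 3 ∣ B
    ((+ 3 ∣ D) → (+ 3 ∣ (A * (C /ℕ N) - + 1)) →
       (+ 3 ∣ theta N p lam N₁ A B C u v v₁ A₁) × (+ 3 ∣ B))
    ×
    -- case (b): D ≡ 1 (mod 3) and A(C/N) ≡ 2 (mod 3)  ⟹  3 ∣ θ and 3 ∤ B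
    ((+ 3 ∣ (D - + 1)) → (+ 3 ∣ (A * (C /ℕ N) - + 2)) →
       (+ 3 ∣ theta N p lam N₁ A B C u v v₁ A₁) × ¬ (+ 3 ∣ B))
mainTheorem4 N _ lam N₁ N≡2^λ*N₁ _ D _ c _ _ _ _ A B C _ disc _ _ N∣C u v p p-prime norm p∤6cN _ p∣C _
  _ _ v₁ A₁ _ _ _ _ _ 3∣N =
    (λ 3∣D 3∣AM-1 →
       let (3∣v[M'-A] , 3∣B) = case-a (∣ᵤ⇒∣ 3∣D) (∣ᵤ⇒∣ {i = A * M - + 1} 3∣AM-1)
       in 3∣theta 3∣v[M'-A] , ∣⇒∣ᵤ 3∣B)
  , (λ 3∣D-1 3∣AM-2 →
       let (3∣v[M'-A] , 3∤B) = case-b (∣ᵤ⇒∣ 3∣D-1) (∣ᵤ⇒∣ {i = A * M - + 2} 3∣AM-2)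
       in 3∣theta 3∣v[M'-A] , λ 3∣B → 3∤B (∣ᵤ⇒∣ 3∣B))
  where
  open LevelDivisibleBy3 c A B C D u v p-prime p∤6cN disc norm
    (∣ᵤ⇒∣ N∣C) (∣ᵤ⇒∣ p∣C) (∣ᵤ⇒∣ 3∣N)

  2∣N : lam ≢ 0 → + 2 ∣ₛ + N
  2∣N λ≢0 = ∣ᵤ⇒∣ (subst (2 ℕ.∣_) (sym N≡2^λ*N₁) (λ≢0⇒2∣2^λ*n lam N₁ λ≢0))

  3∣theta : + 3 ∣ₛ v * (M' - A) → + 3 ∣ theta N p lam N₁ A B C u v v₁ A₁
  3∣theta 3∣v[M'-A] = ∣⇒∣ᵤ (3∣theta-expression (+ N) v u' M' A (u /ℕ p) v₁ A₁ (+ N₁) _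
    (∣ᵤ⇒∣ 3∣N) 3∣v[M'-A] 3∣u'*u'-1
    (3∣[3λy]/ℕ2 lam (u' * u' - + 1) (λ λ≢0 → 2∣N⇒2∣u'*u'-1 (2∣N λ≢0))))
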